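{- For every integer $k\geq 2$ there exists an integer $N_k$ such that for all integers $n\geq \max(N_k,k+1)$, $$f(n)^2-f(n-k)\,f(n+k)>0.$$
   Context: For a positive integer $m$, $f(m)$ denotes the number of nonempty subsets $A\subseteq\{1,2,\dots,m\}$ that are relatively prime, i.e. satisfy $\gcd(A)=1$, where $\gcd(A)$ is the greatest common divisor of all elements of $A$. Equivalently, $f(m)=\sum_{d\le m}\mu(d)\left(2^{\lfloor m/d\rfloor}-1\right)$, with $\mu$ the Möbius function. -}

module Defs where

open import Data.Nat using (ℕ; zero; suc; _≟_)
open import Data.Nat.GCD using (gcd)
open import Data.List using (List; []; _∷_; _++_; map; foldr; length; filter; applyUpTo)
open import Data.Product using (_×_; _,_)
open import Data.Empty using (⊥)
open import Data.Unit using (⊤; tt)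
open import Relation.Nullary using (Dec; yes; no)
open import Relation.Nullary.Decidable using (_×-dec_)
open import Relation.Binary.PropositionalEquality using (_≡_)

-- all sub-lists of a list; for a list of distinct elements these are exactly its subsets
powerList : List ℕ → List (List ℕ)
powerList [] = [] ∷ []
powerList (x ∷ xs) = powerList xs ++ map (x ∷_) (powerList xs)

range1 : ℕ → List ℕ
range1 m = applyUpTo suc m

gcdList : List ℕ → ℕ
gcdList = foldr gcd 0

NonemptyL : List ℕ → Set
NonemptyL [] = ⊥
NonemptyL (_ ∷ _) = ⊤

nonemptyL? : (A : List ℕ) → Dec (NonemptyL A)
nonemptyL? [] = no (λ ())
nonemptyL? (_ ∷ _) = yes tt

RelPrime : List ℕ → Set
RelPrime A = NonemptyL A × (gcdList A ≡ 1)

relPrime? : (A : List ℕ) → Dec (RelPrime A)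
relPrime? A = nonemptyL? A ×-dec (gcdList A ≟ 1)

f : ℕ → ℕ
f m = length (filter relPrime? (powerList (range1 m)))

module Submission where

-- Write fᶜ(m) = 2^m − f(m) for the number of subsets of {1,…,m} that are not relatively
-- prime. The subsets of even numbers give fᶜ(m) ≥ 2^⌊m/2⌋, and a subset that is not
-- relatively prime consists either of even numbers or of multiples of some d ≥ 3, whence
-- fᶜ(m) ≤ 2^⌊m/2⌋ + m·2^⌊m/3⌋. Since 2^(n−k)·2^(n+k) = (2^n)², expanding f = 2^m − fᶜ
-- shows that f(n)² > f(n−k)·f(n+k) follows from
--   fᶜ(n−k)·fᶜ(n+k) + 2·2^n·fᶜ(n) < 2^(n+k)·fᶜ(n−k) + 2^(n−k)·fᶜ(n+k).
-- The main part 2·2^n·2^⌊n/2⌋ of the left side is at most 2^(n+k)·2^⌊(n−k)/2⌋, which is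
-- where k ≥ 2 is needed; all other terms are smaller by exponential factors.

open import Defs
open import Level using (Level)
open import Data.Nat using (ℕ; zero; suc; _+_; _*_; _∸_; _^_; _<_; _≤_; _⊔_; z≤n; s≤s; z<s; NonZero; >-nonZero; >-nonZero⁻¹; _≤?_)
open import Data.Nat.Properties
open import Data.Nat.Divisibility using (_∣_; _∣?_; ∣⇒≤; ∣m+n∣m⇒∣n; ∣m∣n⇒∣m+n; n∣m*n; ∣-refl; ∣-trans; _∣0; 0∣⇒≡0; ∣1⇒≡1)
open import Data.Nat.Tactic.RingSolver using (solve-∀)
open import Data.Nat.GCD using (gcd[m,n]∣m; gcd[m,n]∣n; gcd-greatest)
open import Data.Nat.DivMod using (_/_; _%_; m≡m%n+[m/n]*n; m%n<n; m/n*n≤m; m<n*o⇒m/o<n; m<n⇒m/n≡0; m*n/n≡m; +-distrib-/-∣ʳ; /-monoʳ-≤; /-monoˡ-≤)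
open import Data.List using (List; []; _∷_; _++_; map; length; filter)
open import Data.List.Properties using (length-++; length-map; filter-++; filter-accept; filter-reject; filter-none; applyUpTo-∷ʳ; length-applyUpTo; length-filter)
open import Data.List.Membership.Propositional using (_∈_; lose)
open import Data.List.Membership.Propositional.Properties using (∈-++⁻; ∈-map⁻; ∈-applyUpTo⁺; ∈-applyUpTo⁻; ∈-filter⁺; ∈-filter⁻)
open import Data.List.Relation.Unary.Any using (Any; here; there; any?)
open import Data.List.Relation.Unary.All as All using (All; []; _∷_; all?)
open import Data.List.Relation.Binary.Sublist.Propositional using () renaming (⊆-refl to ⊑-refl)
open import Data.List.Relation.Binary.Sublist.Propositional.Properties using () renaming (filter⁺ to filter-⊑⁺; length-mono-≤ to length-⊑-mono)
open import Data.Product using (Σ; ∃-syntax; _×_; _,_; proj₁; proj₂)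
open import Data.Sum using (_⊎_; inj₁; inj₂)
open import Relation.Unary using (Pred; Decidable; _⊆_)
open import Relation.Unary.Properties using (∁?)
open import Relation.Nullary using (Dec; yes; no; ¬_; contradiction)
open import Relation.Binary.PropositionalEquality
open import Function using (_∘_)

private
  variable
    a ℓ₁ ℓ₂ ℓ₃ : Level
    A : Set a

module _ {P : Pred A ℓ₁} (P? : Decidable P) where

  length-filter+length-filter-∁ : ∀ xs → length (filter P? xs) + length (filter (∁? P?) xs) ≡ length xs
  length-filter+length-filter-∁ [] = refl
  length-filter+length-filter-∁ (x ∷ xs) with P? x
  ... | yes _ = cong suc (length-filter+length-filter-∁ xs)
  ... | no _ = trans (+-suc _ _) (cong suc (length-filter+length-filter-∁ xs))

  length-filter-accept : ∀ {x xs} → P x → length (filter P? (x ∷ xs)) ≡ suc (length (filter P? xs))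
  length-filter-accept px = cong length (filter-accept P? px)

  length-filter-∷ : ∀ x xs → length (filter P? xs) ≤ length (filter P? (x ∷ xs))
  length-filter-∷ x xs with P? x
  ... | yes _ = n≤1+n _
  ... | no _ = ≤-refl

  length-filter-++ : ∀ xs ys → length (filter P? (xs ++ ys)) ≡ length (filter P? xs) + length (filter P? ys)
  length-filter-++ xs ys = trans (cong length (filter-++ P? xs ys)) (length-++ (filter P? xs))

module _ {P : Pred A ℓ₁} {Q : Pred A ℓ₂} (P? : Decidable P) (Q? : Decidable Q) where

  length-filter-mono : P ⊆ Q → ∀ xs → length (filter P? xs) ≤ length (filter Q? xs)
  length-filter-mono P⊆Q xs = length-⊑-mono (filter-⊑⁺ P? Q? {as = xs} (λ { refl → P⊆Q }) ⊑-refl)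

module _ {P : Pred A ℓ₁} {Q : Pred A ℓ₂} {R : Pred A ℓ₃} (P? : Decidable P) (Q? : Decidable Q) (R? : Decidable R) where

  length-filter-∪ : ∀ xs → (∀ {x} → x ∈ xs → P x → Q x ⊎ R x) →
                    length (filter P? xs) ≤ length (filter Q? xs) + length (filter R? xs)
  length-filter-∪ [] _ = z≤n
  length-filter-∪ (x ∷ xs) P⊆Q∪R with P? x | length-filter-∪ xs (P⊆Q∪R ∘ there)
  ... | no _  | ih = ≤-trans ih (+-mono-≤ (length-filter-∷ Q? x xs) (length-filter-∷ R? x xs))
  ... | yes px | ih with P⊆Q∪R (here refl) px
  ...   | inj₁ qx = ≤-trans (s≤s (≤-trans ih (+-monoʳ-≤ _ (length-filter-∷ R? x xs))))
                          (≤-reflexive (cong (_+ _) (sym (length-filter-accept Q? qx))))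
  ...   | inj₂ rx = ≤-trans (s≤s (≤-trans ih (+-monoˡ-≤ _ (length-filter-∷ Q? x xs))))
                          (≤-reflexive (trans (sym (+-suc _ _)) (cong (_ +_) (sym (length-filter-accept R? rx)))))

module _ {D : Set ℓ₁} {Q : D → Pred A ℓ₂} (Q? : ∀ d → Decidable (Q d)) where

  Any-Q? : ∀ ds → Decidable (λ x → Any (λ d → Q d x) ds)
  Any-Q? ds x = any? (λ d → Q? d x) ds

  length-filter-Any≤ : ∀ ds xs {B} → (∀ {d} → d ∈ ds → length (filter (Q? d) xs) ≤ B) →
                       length (filter (Any-Q? ds) xs) ≤ length ds * B
  length-filter-Any≤ [] xs _ = ≤-reflexive (cong length (filter-none (Any-Q? []) (All.universal (λ _ ()) xs)))
  length-filter-Any≤ (d ∷ ds) xs {B} bound = begin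
    length (filter (Any-Q? (d ∷ ds)) xs)                             ≤⟨ length-filter-∪ (Any-Q? (d ∷ ds)) (Q? d) (Any-Q? ds) xs split ⟩
    length (filter (Q? d) xs) + length (filter (Any-Q? ds) xs)      ≤⟨ +-mono-≤ (bound (here refl)) (length-filter-Any≤ ds xs (bound ∘ there)) ⟩
    B + length ds * B                                                ∎
    where
    open ≤-Reasoning
    split : ∀ {x} → x ∈ xs → Any (λ d → Q d x) (d ∷ ds) → Q d x ⊎ Any (λ d → Q d x) ds
    split _ (here qx) = inj₁ qx
    split _ (there qx) = inj₂ qx

length-powerList : ∀ xs → length (powerList xs) ≡ 2 ^ length xs
length-powerList [] = refl
length-powerList (x ∷ xs) = begin
  length (powerList xs ++ map (x ∷_) (powerList xs))          ≡⟨ length-++ (powerList xs) ⟩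
  length (powerList xs) + length (map (x ∷_) (powerList xs))  ≡⟨ cong (length (powerList xs) +_) (length-map (x ∷_) (powerList xs)) ⟩
  length (powerList xs) + length (powerList xs)               ≡⟨ cong (λ l → l + l) (length-powerList xs) ⟩
  2 ^ length xs + 2 ^ length xs                               ≡⟨ cong (2 ^ length xs +_) (+-identityʳ _) ⟨
  2 ^ length (x ∷ xs)                                         ∎
  where open ≡-Reasoning

powerList-⊆ : ∀ {B} xs → B ∈ powerList xs → ∀ {y} → y ∈ B → y ∈ xs
powerList-⊆ [] (here refl) ()
powerList-⊆ (x ∷ xs) B∈ y∈B with ∈-++⁻ (powerList xs) B∈
... | inj₁ B∈′ = there (powerList-⊆ xs B∈′ y∈B)
... | inj₂ B∈x∷ with ∈-map⁻ (x ∷_) B∈x∷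
...   | C , C∈ , refl with y∈B
...     | here refl = here refl
...     | there y∈C = there (powerList-⊆ xs C∈ y∈C)

module _ {D : Pred ℕ ℓ₁} (D? : Decidable D) where

  filter-All-map-∷ : ∀ {x} → D x → ∀ Bs → filter (all? D?) (map (x ∷_) Bs) ≡ map (x ∷_) (filter (all? D?) Bs)
  filter-All-map-∷ dx [] = refl
  filter-All-map-∷ {x} dx (B ∷ Bs) = by-cases (all? D? B)
    where
    by-cases : Dec (All D B) → filter (all? D?) (map (x ∷_) (B ∷ Bs)) ≡ map (x ∷_) (filter (all? D?) (B ∷ Bs))
    by-cases (yes allB) = begin
      filter (all? D?) ((x ∷ B) ∷ map (x ∷_) Bs)    ≡⟨ filter-accept (all? D?) (dx ∷ allB) ⟩
      (x ∷ B) ∷ filter (all? D?) (map (x ∷_) Bs)    ≡⟨ cong ((x ∷ B) ∷_) (filter-All-map-∷ dx Bs) ⟩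
      map (x ∷_) (B ∷ filter (all? D?) Bs)          ≡⟨ cong (map (x ∷_)) (filter-accept (all? D?) allB) ⟨
      map (x ∷_) (filter (all? D?) (B ∷ Bs))        ∎
      where open ≡-Reasoning
    by-cases (no ¬allB) = begin
      filter (all? D?) ((x ∷ B) ∷ map (x ∷_) Bs)    ≡⟨ filter-reject (all? D?) {x = x ∷ B} {xs = map (x ∷_) Bs} (λ { (_ ∷ allB) → ¬allB allB }) ⟩
      filter (all? D?) (map (x ∷_) Bs)              ≡⟨ filter-All-map-∷ dx Bs ⟩
      map (x ∷_) (filter (all? D?) Bs)              ≡⟨ cong (map (x ∷_)) (filter-reject (all? D?) ¬allB) ⟨
      map (x ∷_) (filter (all? D?) (B ∷ Bs))        ∎
      where open ≡-Reasoning

  filter-All-map-∷-reject : ∀ {x} → ¬ D x → ∀ Bs → filter (all? D?) (map (x ∷_) Bs) ≡ []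
  filter-All-map-∷-reject ¬dx [] = refl
  filter-All-map-∷-reject {x} ¬dx (B ∷ Bs) =
    trans (filter-reject (all? D?) {x = x ∷ B} {xs = map (x ∷_) Bs} λ { (dx ∷ _) → ¬dx dx }) (filter-All-map-∷-reject ¬dx Bs)

  length-filter-All-powerList : ∀ xs → length (filter (all? D?) (powerList xs)) ≡ 2 ^ length (filter D? xs)
  length-filter-All-powerList [] = refl
  length-filter-All-powerList (x ∷ xs) with D? x
  ... | yes dx = trans split (cong₂ _+_ ih (begin
    length (filter (all? D?) (map (x ∷_) (powerList xs)))  ≡⟨ cong length (filter-All-map-∷ dx (powerList xs)) ⟩
    length (map (x ∷_) (filter (all? D?) (powerList xs)))  ≡⟨ length-map (x ∷_) (filter (all? D?) (powerList xs)) ⟩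
    length (filter (all? D?) (powerList xs))               ≡⟨ ih ⟩
    2 ^ length (filter D? xs)                              ≡⟨ +-identityʳ _ ⟨
    2 ^ length (filter D? xs) + 0                          ∎))
    where open ≡-Reasoning
          ih = length-filter-All-powerList xs
          split = length-filter-++ (all? D?) (powerList xs) (map (x ∷_) (powerList xs))
  ... | no ¬dx = trans split (trans (cong₂ _+_ ih (cong length (filter-All-map-∷-reject ¬dx (powerList xs)))) (+-identityʳ _))
    where ih = length-filter-All-powerList xs
          split = length-filter-++ (all? D?) (powerList xs) (map (x ∷_) (powerList xs))

[m*n+o]/n≡m : ∀ m {n o} .{{_ : NonZero n}} → o < n → (m * n + o) / n ≡ m
[m*n+o]/n≡m m {n} {o} o<n = begin
  (m * n + o) / n    ≡⟨ cong (_/ n) (+-comm (m * n) o) ⟩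
  (o + m * n) / n    ≡⟨ +-distrib-/-∣ʳ o (n∣m*n m) ⟩
  o / n + m * n / n  ≡⟨ cong₂ _+_ (m<n⇒m/n≡0 o<n) (m*n/n≡m m n) ⟩
  m                  ∎
  where open ≡-Reasoning

m<[1+m/n]*n : ∀ m n .{{_ : NonZero n}} → m < suc (m / n) * n
m<[1+m/n]*n m n = begin-strict
  m                  ≡⟨ m≡m%n+[m/n]*n m n ⟩
  m % n + m / n * n  <⟨ +-monoˡ-< (m / n * n) (m%n<n m n) ⟩
  suc (m / n) * n    ∎
  where open ≤-Reasoning

[m+k]/2<m/2+k : ∀ m {k} → 2 ≤ k → (m + k) / 2 < m / 2 + k
[m+k]/2<m/2+k m {k} 2≤k = begin-strict
  (m + k) / 2          <⟨ m<m+n _ z<s ⟩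
  (m + k) / 2 + 1      ≡⟨ +-distrib-/-∣ʳ (m + k) (n∣m*n 1) ⟨
  (m + k + 2) / 2      ≤⟨ /-monoˡ-≤ 2 (+-monoʳ-≤ (m + k) 2≤k) ⟩
  (m + k + k) / 2      ≡⟨ cong (_/ 2) (double m k) ⟩
  (m + k * 2) / 2      ≡⟨ +-distrib-/-∣ʳ m (n∣m*n k) ⟩
  m / 2 + k * 2 / 2    ≡⟨ cong (m / 2 +_) (m*n/n≡m k 2) ⟩
  m / 2 + k            ∎
  where
  open ≤-Reasoning
  double : ∀ m k → m + k + k ≡ m + k * 2
  double = solve-∀

multiples : ℕ → ℕ → List ℕ
multiples d m = filter (d ∣?_) (range1 m)

length-multiples-suc : ∀ d m → length (multiples d (suc m)) ≡ length (multiples d m) + length (filter (d ∣?_) (suc m ∷ []))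
length-multiples-suc d m =
  trans (cong (λ xs → length (filter (d ∣?_) xs)) (sym (applyUpTo-∷ʳ suc m)))
        (length-filter-++ (d ∣?_) (range1 m) (suc m ∷ []))

multiples-divMod : ∀ d m .{{_ : NonZero d}} → ∃[ r ] r < d × length (multiples d m) * d + r ≡ m
multiples-divMod d zero = 0 , >-nonZero⁻¹ d , refl
multiples-divMod d (suc m) with multiples-divMod d m | d ∣? suc m
... | r , r<d , c*d+r≡m | yes d∣1+m = 0 , >-nonZero⁻¹ d , (begin
  length (multiples d (suc m)) * d + 0  ≡⟨ +-identityʳ _ ⟩
  length (multiples d (suc m)) * d      ≡⟨ cong (_* d) (length-multiples-suc d m) ⟩
  (c + length (filter (d ∣?_) (suc m ∷ []))) * d
                                        ≡⟨ cong (λ l → (c + l) * d) (length-filter-accept (d ∣?_) d∣1+m) ⟩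
  (c + 1) * d                           ≡⟨ trans (*-distribʳ-+ d c 1) (cong (c * d +_) (*-identityˡ d)) ⟩
  c * d + d                             ≡⟨ cong (c * d +_) d≡1+r ⟩
  c * d + suc r                         ≡⟨ +-suc (c * d) r ⟩
  suc (c * d + r)                       ≡⟨ cong suc c*d+r≡m ⟩
  suc m                                 ∎)
  where
  open ≡-Reasoning
  c = length (multiples d m)
  1+m≡c*d+1+r : suc m ≡ c * d + suc r
  1+m≡c*d+1+r = trans (cong suc (sym c*d+r≡m)) (sym (+-suc (c * d) r))
  d≡1+r : d ≡ suc r
  d≡1+r = ≤-antisym (∣⇒≤ (∣m+n∣m⇒∣n (subst (d ∣_) 1+m≡c*d+1+r d∣1+m) (n∣m*n c))) r<d
... | r , r<d , c*d+r≡m | no d∤1+m = suc r , 1+r<d , (begin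
  length (multiples d (suc m)) * d + suc r  ≡⟨ cong (λ l → l * d + suc r) (length-multiples-suc d m) ⟩
  (c + length (filter (d ∣?_) (suc m ∷ []))) * d + suc r
                                            ≡⟨ cong (λ l → (c + length l) * d + suc r) (filter-reject (d ∣?_) d∤1+m) ⟩
  (c + 0) * d + suc r                       ≡⟨ cong (λ l → l * d + suc r) (+-identityʳ c) ⟩
  c * d + suc r                             ≡⟨ +-suc (c * d) r ⟩
  suc (c * d + r)                           ≡⟨ cong suc c*d+r≡m ⟩
  suc m                                     ∎)
  where
  open ≡-Reasoning
  c = length (multiples d m)
  1+r<d : suc r < d
  1+r<d = ≤∧≢⇒< r<d λ 1+r≡d → d∤1+m (subst (d ∣_) (trans (cong (c * d +_) (sym 1+r≡d)) (trans (+-suc (c * d) r) (cong suc c*d+r≡m)))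
                                               (∣m∣n⇒∣m+n (n∣m*n c) ∣-refl))

length-multiples : ∀ d m .{{_ : NonZero d}} → length (multiples d m) ≡ m / d
length-multiples d m with multiples-divMod d m
... | r , r<d , c*d+r≡m = sym (trans (cong (_/ d) (sym c*d+r≡m)) ([m*n+o]/n≡m _ r<d))

gcdList-∣ : ∀ A → All (gcdList A ∣_) A
gcdList-∣ [] = []
gcdList-∣ (x ∷ A) = gcd[m,n]∣m x (gcdList A) ∷ All.map (∣-trans (gcd[m,n]∣n x (gcdList A))) (gcdList-∣ A)

∣-gcdList : ∀ {d} A → All (d ∣_) A → d ∣ gcdList A
∣-gcdList [] [] = _ ∣0
∣-gcdList (x ∷ A) (d∣x ∷ d∣A) = gcd-greatest d∣x (∣-gcdList A d∣A)

All-even⇒¬RelPrime : ∀ A → All (2 ∣_) A → ¬ RelPrime A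
All-even⇒¬RelPrime (x ∷ A) 2∣A (_ , gcd≡1) with ∣1⇒≡1 (subst (2 ∣_) gcd≡1 (∣-gcdList (x ∷ A) 2∣A))
... | ()

∈-range1⁻ : ∀ {x m} → x ∈ range1 m → 1 ≤ x × x ≤ m
∈-range1⁻ x∈ with ∈-applyUpTo⁻ suc x∈
... | _ , i<m , refl = s≤s z≤n , i<m

∈-range1⁺ : ∀ {x m} → 1 ≤ x → x ≤ m → x ∈ range1 m
∈-range1⁺ {suc x} _ x<m = ∈-applyUpTo⁺ suc x<m

odd-non-unit⇒3≤ : ∀ {g} → g ≢ 0 → g ≢ 1 → ¬ 2 ∣ g → 3 ≤ g
odd-non-unit⇒3≤ {0} g≢0 _ _ = contradiction refl g≢0
odd-non-unit⇒3≤ {1} _ g≢1 _ = contradiction refl g≢1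
odd-non-unit⇒3≤ {2} _ _ 2∤g = contradiction ∣-refl 2∤g
odd-non-unit⇒3≤ {suc (suc (suc _))} _ _ _ = s≤s (s≤s (s≤s z≤n))

¬RelPrime⇒even⊎common-divisor : ∀ m A → (∀ {x} → x ∈ A → x ∈ range1 m) → ¬ RelPrime A →
                                 All (2 ∣_) A ⊎ Any (λ d → All (d ∣_) A) (filter (3 ≤?_) (range1 m))
¬RelPrime⇒even⊎common-divisor m [] _ _ = inj₁ []
¬RelPrime⇒even⊎common-divisor m (x ∷ A) A⊆ ¬rp with 2 ∣? gcdList (x ∷ A)
... | yes 2∣g = inj₁ (All.map (∣-trans 2∣g) (gcdList-∣ (x ∷ A)))
... | no 2∤g = inj₂ (lose (∈-filter⁺ (3 ≤?_) (∈-range1⁺ (≤-trans (s≤s z≤n) 3≤g) g≤m) 3≤g) (gcdList-∣ (x ∷ A)))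
  where
  g = gcdList (x ∷ A)
  x∈range = ∈-range1⁻ (A⊆ (here refl))
  g∣x : g ∣ x
  g∣x = gcd[m,n]∣m x (gcdList A)
  g≢0 : g ≢ 0
  g≢0 g≡0 = <⇒≢ (proj₁ x∈range) (sym (0∣⇒≡0 (subst (_∣ x) g≡0 g∣x)))
  g≤m : g ≤ m
  g≤m = ≤-trans (∣⇒≤ ⦃ >-nonZero (proj₁ x∈range) ⦄ g∣x) (proj₂ x∈range)
  3≤g : 3 ≤ g
  3≤g = odd-non-unit⇒3≤ g≢0 (λ g≡1 → ¬rp (_ , g≡1)) 2∤g

subsets : ℕ → List (List ℕ)
subsets m = powerList (range1 m)

fᶜ : ℕ → ℕ
fᶜ m = length (filter (∁? relPrime?) (subsets m))

f+fᶜ≡2^ : ∀ m → f m + fᶜ m ≡ 2 ^ m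
f+fᶜ≡2^ m = begin
  f m + fᶜ m              ≡⟨ length-filter+length-filter-∁ relPrime? (subsets m) ⟩
  length (subsets m)      ≡⟨ length-powerList (range1 m) ⟩
  2 ^ length (range1 m)   ≡⟨ cong (2 ^_) (length-applyUpTo suc m) ⟩
  2 ^ m                   ∎
  where open ≡-Reasoning

subsets-divisible-by : ∀ d m .{{_ : NonZero d}} → length (filter (all? (d ∣?_)) (subsets m)) ≡ 2 ^ (m / d)
subsets-divisible-by d m = trans (length-filter-All-powerList (d ∣?_) (range1 m)) (cong (2 ^_) (length-multiples d m))

2^[m/2]≤fᶜ : ∀ m → 2 ^ (m / 2) ≤ fᶜ m
2^[m/2]≤fᶜ m = begin
  2 ^ (m / 2)                                     ≡⟨ subsets-divisible-by 2 m ⟨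
  length (filter (all? (2 ∣?_)) (subsets m))     ≤⟨ length-filter-mono (all? (2 ∣?_)) (∁? relPrime?) (λ {A} → All-even⇒¬RelPrime A) (subsets m) ⟩
  fᶜ m                                            ∎
  where open ≤-Reasoning

fᶜ≤2^[m/2]+m*2^[m/3] : ∀ m → fᶜ m ≤ 2 ^ (m / 2) + m * 2 ^ (m / 3)
fᶜ≤2^[m/2]+m*2^[m/3] m = begin
  fᶜ m
    ≤⟨ length-filter-∪ (∁? relPrime?) (all? (2 ∣?_)) (Any-Q? divisible? divisors) (subsets m) classify ⟩
  length (filter (all? (2 ∣?_)) (subsets m)) + length (filter (Any-Q? divisible? divisors) (subsets m))
    ≤⟨ +-mono-≤ (≤-reflexive (subsets-divisible-by 2 m)) (length-filter-Any≤ divisible? divisors (subsets m) bound) ⟩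
  2 ^ (m / 2) + length divisors * 2 ^ (m / 3)
    ≤⟨ +-monoʳ-≤ (2 ^ (m / 2)) (*-monoˡ-≤ _ length-divisors) ⟩
  2 ^ (m / 2) + m * 2 ^ (m / 3)
    ∎
  where
  open ≤-Reasoning
  divisors = filter (3 ≤?_) (range1 m)
  divisible? : ∀ d → Decidable (All (d ∣_))
  divisible? d = all? (d ∣?_)
  classify : ∀ {A} → A ∈ subsets m → ¬ RelPrime A → All (2 ∣_) A ⊎ Any (λ d → All (d ∣_) A) divisors
  classify {A} A∈ = ¬RelPrime⇒even⊎common-divisor m A (powerList-⊆ (range1 m) A∈)
  bound : ∀ {d} → d ∈ divisors → length (filter (divisible? d) (subsets m)) ≤ 2 ^ (m / 3)
  bound {d} d∈ = ≤-trans (≤-reflexive (subsets-divisible-by d m ⦃ d≢0 ⦄)) (^-monoʳ-≤ 2 (/-monoʳ-≤ m ⦃ d≢0 ⦄ 3≤d))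
    where
    3≤d = proj₂ (∈-filter⁻ (3 ≤?_) {xs = range1 m} d∈)
    d≢0 = >-nonZero (≤-trans (s≤s z≤n) 3≤d)
  length-divisors : length divisors ≤ m
  length-divisors = ≤-trans (length-filter (3 ≤?_) (range1 m)) (≤-reflexive (length-applyUpTo suc m))

log-concave-from-complements : ∀ {F₁ F₂ F₃ C₁ C₂ C₃ P Q S} →
  F₁ + C₁ ≡ P → F₂ + C₂ ≡ Q → F₃ + C₃ ≡ S → P * S ≡ Q * Q →
  C₁ * C₃ + 2 * Q * C₂ < C₁ * S + C₃ * P → F₁ * F₃ < F₂ * F₂
log-concave-from-complements {F₁} {F₂} {F₃} {C₁} {C₂} {C₃} refl refl refl PS≡QQ estimate =
  +-cancelʳ-< X (F₁ * F₃) (F₂ * F₂) (begin-strict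
    F₁ * F₃ + X                                    ≡⟨ expand₁ F₁ F₃ C₁ C₃ ⟩
    P * S + C₁ * C₃                                ≡⟨ cong (_+ C₁ * C₃) PS≡QQ ⟩
    Q * Q + C₁ * C₃                                ≤⟨ +-monoˡ-≤ (C₁ * C₃) (m≤m+n (Q * Q) (C₂ * C₂)) ⟩
    Q * Q + C₂ * C₂ + C₁ * C₃                      ≡⟨ expand₂ F₂ C₂ (C₁ * C₃) ⟩
    F₂ * F₂ + (C₁ * C₃ + 2 * Q * C₂)               <⟨ +-monoʳ-< (F₂ * F₂) estimate ⟩
    F₂ * F₂ + X                                    ∎)
  where
  open ≤-Reasoning
  P = F₁ + C₁
  Q = F₂ + C₂
  S = F₃ + C₃
  X = C₁ * S + C₃ * P
  expand₁ : ∀ F₁ F₃ C₁ C₃ → F₁ * F₃ + (C₁ * (F₃ + C₃) + C₃ * (F₁ + C₁)) ≡ (F₁ + C₁) * (F₃ + C₃) + C₁ * C₃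
  expand₁ = solve-∀
  expand₂ : ∀ F₂ C₂ Y → (F₂ + C₂) * (F₂ + C₂) + C₂ * C₂ + Y ≡ F₂ * F₂ + (Y + 2 * (F₂ + C₂) * C₂)
  expand₂ = solve-∀

complement-estimate : ∀ {P W C₁ C₂ C₃ Z E} → 0 < P →
  4 * C₁ ≤ P → 2 * Z ≤ C₁ * W → C₂ ≤ Z + E → W * 4 * E < Z → Z ≤ C₃ →
  C₁ * C₃ + 2 * (P * W) * C₂ < C₁ * (P * W * W) + C₃ * P
complement-estimate {P} {W} {C₁} {C₂} {C₃} {Z} {E} 0<P 4C₁≤P 2Z≤C₁W C₂≤Z+E 4WE<Z Z≤C₃ = begin-strict
  C₁ * C₃ + 2 * (P * W) * C₂                           ≤⟨ +-monoʳ-≤ (C₁ * C₃) (*-monoʳ-≤ (2 * (P * W)) C₂≤Z+E) ⟩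
  C₁ * C₃ + 2 * (P * W) * (Z + E)                      ≡⟨ regroup C₁ C₃ P W Z E ⟩
  (C₁ * C₃ + 2 * (P * W) * E) + P * W * (2 * Z)        <⟨ +-mono-<-≤ small (*-monoʳ-≤ (P * W) 2Z≤C₁W) ⟩
  C₃ * P + P * W * (C₁ * W)                            ≡⟨ cong (C₃ * P +_) (shuffle P W C₁) ⟩
  C₃ * P + C₁ * (P * W * W)                            ≡⟨ +-comm (C₃ * P) _ ⟩
  C₁ * (P * W * W) + C₃ * P                            ∎
  where
  open ≤-Reasoning
  regroup : ∀ C₁ C₃ P W Z E → C₁ * C₃ + 2 * (P * W) * (Z + E) ≡ (C₁ * C₃ + 2 * (P * W) * E) + P * W * (2 * Z)
  regroup = solve-∀
  shuffle : ∀ P W C₁ → P * W * (C₁ * W) ≡ C₁ * (P * W * W)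
  shuffle = solve-∀
  expand : ∀ C₁ C₃ P W E → 4 * (C₁ * C₃ + 2 * (P * W) * E) ≡ 4 * C₁ * C₃ + 2 * P * (W * 4 * E)
  expand = solve-∀
  collect : ∀ P C₃ → P * C₃ + 2 * P * C₃ + P * C₃ ≡ 4 * (C₃ * P)
  collect = solve-∀
  instance _ = >-nonZero (*-monoʳ-< 2 0<P)
  small : C₁ * C₃ + 2 * (P * W) * E < C₃ * P
  small = *-cancelˡ-< 4 _ _ (begin-strict
    4 * (C₁ * C₃ + 2 * (P * W) * E)               ≡⟨ expand C₁ C₃ P W E ⟩
    4 * C₁ * C₃ + 2 * P * (W * 4 * E)             <⟨ +-mono-≤-< (*-monoˡ-≤ C₃ 4C₁≤P) (*-monoʳ-< (2 * P) 4WE<Z) ⟩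
    P * C₃ + 2 * P * Z                            ≤⟨ +-monoʳ-≤ (P * C₃) (*-monoʳ-≤ (2 * P) Z≤C₃) ⟩
    P * C₃ + 2 * P * C₃                           ≤⟨ m≤m+n _ (P * C₃) ⟩
    P * C₃ + 2 * P * C₃ + P * C₃                  ≡⟨ collect P C₃ ⟩
    4 * (C₃ * P)                                  ∎)

Eventually : (ℕ → Set ℓ₁) → Set ℓ₁
Eventually P = ∃[ N ] ∀ n → N ≤ n → P n

eventually-mono : ∀ {P Q : ℕ → Set ℓ₁} → (∀ n → P n → Q n) → Eventually P → Eventually Q
eventually-mono P⇒Q (N , PN) = N , λ n N≤n → P⇒Q n (PN n N≤n)

eventually-from : ∀ {P : ℕ → Set ℓ₁} N → P N → (∀ n → P n → P (suc n)) → Eventually P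
eventually-from {P = P} N PN step = N , λ n N≤n → subst P (m+[n∸m]≡n N≤n) (from (n ∸ N))
  where
  from : ∀ d → P (N + d)
  from zero = subst P (sym (+-identityʳ N)) PN
  from (suc d) = subst P (sym (+-suc N d)) (step (N + d) (from d))

eventually-/ : ∀ {P : ℕ → Set ℓ₁} d .{{_ : NonZero d}} → Eventually P → Eventually (λ n → P (n / d))
eventually-/ d (N , PN) = N * d , λ n N*d≤n → PN (n / d) (subst (_≤ n / d) (m*n/n≡m N d) (/-monoˡ-≤ d N*d≤n))

2*b+5<2^[b+4] : ∀ b → 2 * b + 5 < 2 ^ (b + 4)
2*b+5<2^[b+4] zero = m≤m+n 6 10
2*b+5<2^[b+4] (suc b) = ≤-trans (≤-trans (m≤m+n _ (2 * b + 4)) (≤-reflexive (double b))) (*-monoʳ-≤ 2 (2*b+5<2^[b+4] b))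
  where
  double : ∀ b → suc (2 * suc b + 5) + (2 * b + 4) ≡ 2 * suc (2 * b + 5)
  double = solve-∀

[x+1]*2^b<2^x : ∀ b → Eventually (λ x → (x + 1) * 2 ^ b < 2 ^ x)
[x+1]*2^b<2^x b = eventually-from (2 * b + 4) base step
  where
  base : (2 * b + 4 + 1) * 2 ^ b < 2 ^ (2 * b + 4)
  base = begin-strict
    (2 * b + 4 + 1) * 2 ^ b    ≡⟨ cong (_* 2 ^ b) (+-assoc (2 * b) 4 1) ⟩
    (2 * b + 5) * 2 ^ b        <⟨ *-monoˡ-< (2 ^ b) ⦃ m^n≢0 2 b ⦄ (2*b+5<2^[b+4] b) ⟩
    2 ^ (b + 4) * 2 ^ b        ≡⟨ ^-distribˡ-+-* 2 (b + 4) b ⟨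
    2 ^ (b + 4 + b)            ≡⟨ cong (2 ^_) (exponent b) ⟩
    2 ^ (2 * b + 4)            ∎
    where
    open ≤-Reasoning
    exponent : ∀ b → b + 4 + b ≡ 2 * b + 4
    exponent = solve-∀
  step : ∀ x → (x + 1) * 2 ^ b < 2 ^ x → (suc x + 1) * 2 ^ b < 2 ^ suc x
  step x ih = begin-strict
    (suc x + 1) * 2 ^ b              ≤⟨ m≤m+n _ (x * 2 ^ b) ⟩
    (suc x + 1) * 2 ^ b + x * 2 ^ b  ≡⟨ twice x (2 ^ b) ⟩
    2 * ((x + 1) * 2 ^ b)            <⟨ *-monoʳ-< 2 ih ⟩
    2 ^ suc x                        ∎
    where
    open ≤-Reasoning
    twice : ∀ x c → (suc x + 1) * c + x * c ≡ 2 * ((x + 1) * c)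
    twice = solve-∀

4*fᶜ≤2^ : Eventually (λ m → 4 * fᶜ m ≤ 2 ^ m)
4*fᶜ≤2^ = eventually-mono bound (eventually-/ 2 ([x+1]*2^b<2^x 3))
  where
  bound : ∀ m → (m / 2 + 1) * 2 ^ 3 < 2 ^ (m / 2) → 4 * fᶜ m ≤ 2 ^ m
  bound m linear<exp = begin
    4 * fᶜ m                           ≤⟨ *-monoʳ-≤ 4 (fᶜ≤2^[m/2]+m*2^[m/3] m) ⟩
    4 * (Z + m * 2 ^ (m / 3))          ≤⟨ *-monoʳ-≤ 4 (+-monoʳ-≤ Z (*-monoʳ-≤ m (^-monoʳ-≤ 2 (/-monoʳ-≤ m (n≤1+n 2))))) ⟩
    4 * (Z + m * Z)                    ≡⟨ factor m Z ⟩
    (m + 1) * 4 * Z                    ≤⟨ *-monoˡ-≤ Z (*-monoˡ-≤ 4 (≤-trans (≤-reflexive (+-comm m 1)) (m<[1+m/n]*n m 2))) ⟩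
    suc h * 2 * 4 * Z                  ≡⟨ cong (_* Z) (regroup h) ⟩
    (h + 1) * 8 * Z                    ≤⟨ *-monoˡ-≤ Z (<⇒≤ linear<exp) ⟩
    Z * Z                              ≡⟨ ^-distribˡ-+-* 2 h h ⟨
    2 ^ (h + h)                        ≤⟨ ^-monoʳ-≤ 2 (≤-trans (≤-reflexive (double h)) (m/n*n≤m m 2)) ⟩
    2 ^ m                              ∎
    where
    open ≤-Reasoning
    h = m / 2
    Z = 2 ^ h
    factor : ∀ m z → 4 * (z + m * z) ≡ (m + 1) * 4 * z
    factor = solve-∀
    regroup : ∀ h → suc h * 2 * 4 ≡ (h + 1) * 8
    regroup = solve-∀
    double : ∀ h → h + h ≡ h * 2
    double = solve-∀

2^k*4*[n*2^[n/3]]<2^[n/2] : ∀ k → Eventually (λ n → 2 ^ k * 4 * (n * 2 ^ (n / 3)) < 2 ^ (n / 2))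
2^k*4*[n*2^[n/3]]<2^[n/2] k = eventually-mono bound (eventually-/ 6 ([x+1]*2^b<2^x (k + 6)))
  where
  bound : ∀ n → (n / 6 + 1) * 2 ^ (k + 6) < 2 ^ (n / 6) → 2 ^ k * 4 * (n * 2 ^ (n / 3)) < 2 ^ (n / 2)
  bound n linear<exp = begin-strict
    W * 4 * (n * 2 ^ (n / 3))                ≤⟨ *-monoʳ-≤ (W * 4) (*-mono-≤ (<⇒≤ n<[q+1]*6) (^-monoʳ-≤ 2 n/3≤1+2q)) ⟩
    W * 4 * ((q + 1) * 6 * (2 * H))          ≡⟨ regroup W q H ⟩
    (q + 1) * 48 * (W * H)                   ≤⟨ *-monoˡ-≤ (W * H) (*-monoʳ-≤ (q + 1) (m≤m+n 48 16)) ⟩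
    (q + 1) * 64 * (W * H)                   ≡⟨ reassoc q W H ⟩
    (q + 1) * (W * 64) * H                   ≡⟨ cong (λ c → (q + 1) * c * H) (^-distribˡ-+-* 2 k 6) ⟨
    (q + 1) * 2 ^ (k + 6) * H                <⟨ *-monoˡ-< H ⦃ m^n≢0 2 (q + q) ⦄ linear<exp ⟩
    2 ^ q * H                                ≡⟨ ^-distribˡ-+-* 2 q (q + q) ⟨
    2 ^ (q + (q + q))                        ≤⟨ ^-monoʳ-≤ 2 3q≤n/2 ⟩
    2 ^ (n / 2)                              ∎
    where
    open ≤-Reasoning
    W = 2 ^ k
    q = n / 6
    H = 2 ^ (q + q)
    sextuple : ∀ q → (q + 1) * 6 ≡ suc (suc (q + q)) * 3
    sextuple = solve-∀
    triple : ∀ q → q * 6 ≡ (q + (q + q)) * 2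
    triple = solve-∀
    n<[q+1]*6 : n < (q + 1) * 6
    n<[q+1]*6 = subst (n <_) (cong (_* 6) (+-comm 1 q)) (m<[1+m/n]*n n 6)
    n/3≤1+2q : n / 3 ≤ suc (q + q)
    n/3≤1+2q = ≤-pred (m<n*o⇒m/o<n (subst (n <_) (sextuple q) n<[q+1]*6))
    3q≤n/2 : q + (q + q) ≤ n / 2
    3q≤n/2 = subst (_≤ n / 2) (m*n/n≡m (q + (q + q)) 2) (/-monoˡ-≤ 2 (subst (_≤ n) (triple q) (m/n*n≤m n 6)))
    regroup : ∀ W q H → W * 4 * ((q + 1) * 6 * (2 * H)) ≡ (q + 1) * 48 * (W * H)
    regroup = solve-∀
    reassoc : ∀ q W H → (q + 1) * 64 * (W * H) ≡ (q + 1) * (W * 64) * H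
    reassoc = solve-∀

f-log-concave-at : ∀ {k m n} → 2 ≤ k → m + k ≡ n → 4 * fᶜ m ≤ 2 ^ m →
                   2 ^ k * 4 * (n * 2 ^ (n / 3)) < 2 ^ (n / 2) → f m * f (n + k) < f n * f n
f-log-concave-at {k} {m} 2≤k refl 4fᶜ≤2^m error<2^[n/2] =
  log-concave-from-complements {F₁ = f m} {f n} {f (n + k)}
    (f+fᶜ≡2^ m) (trans (f+fᶜ≡2^ n) 2^[m+k]) (trans (f+fᶜ≡2^ (n + k)) 2^[m+k+k]) (square (2 ^ m) W)
    (complement-estimate {W = W} {C₁ = fᶜ m}
      (m^n>0 2 m) 4fᶜ≤2^m 2Z≤fᶜm*W (fᶜ≤2^[m/2]+m*2^[m/3] n) error<2^[n/2] Z≤fᶜ[n+k])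
  where
  n = m + k
  W = 2 ^ k
  2^[m+k] : 2 ^ n ≡ 2 ^ m * W
  2^[m+k] = ^-distribˡ-+-* 2 m k
  2^[m+k+k] : 2 ^ (n + k) ≡ 2 ^ m * W * W
  2^[m+k+k] = trans (^-distribˡ-+-* 2 n k) (cong (_* W) 2^[m+k])
  square : ∀ P W → P * (P * W * W) ≡ P * W * (P * W)
  square = solve-∀
  2Z≤fᶜm*W : 2 * 2 ^ (n / 2) ≤ fᶜ m * W
  2Z≤fᶜm*W = begin
    2 ^ suc (n / 2)      ≤⟨ ^-monoʳ-≤ 2 ([m+k]/2<m/2+k m 2≤k) ⟩
    2 ^ (m / 2 + k)      ≡⟨ ^-distribˡ-+-* 2 (m / 2) k ⟩
    2 ^ (m / 2) * W      ≤⟨ *-monoˡ-≤ W (2^[m/2]≤fᶜ m) ⟩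
    fᶜ m * W             ∎
    where open ≤-Reasoning
  Z≤fᶜ[n+k] : 2 ^ (n / 2) ≤ fᶜ (n + k)
  Z≤fᶜ[n+k] = ≤-trans (^-monoʳ-≤ 2 (/-monoˡ-≤ 2 (m≤m+n n k))) (2^[m/2]≤fᶜ (n + k))

mainTheorem1 : (k : ℕ) → 2 ≤ k → Σ ℕ (λ N → (n : ℕ) → N ⊔ (k + 1) ≤ n → f (n ∸ k) * f (n + k) < f n * f n)
mainTheorem1 k 2≤k = N , log-concave
  where
  open Σ 4*fᶜ≤2^ renaming (proj₁ to M₀; proj₂ to fᶜ-small)
  open Σ (2^k*4*[n*2^[n/3]]<2^[n/2] k) renaming (proj₁ to M₁; proj₂ to error-small)
  N = (M₀ + k) ⊔ M₁
  log-concave : ∀ n → N ⊔ (k + 1) ≤ n → f (n ∸ k) * f (n + k) < f n * f n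
  log-concave n N⊔[k+1]≤n =
    f-log-concave-at 2≤k (m∸n+n≡m k≤n) (fᶜ-small (n ∸ k) (m+n≤o⇒m≤o∸n M₀ M₀+k≤n)) (error-small n M₁≤n)
    where
    N≤n = m⊔n≤o⇒m≤o N (k + 1) N⊔[k+1]≤n
    k≤n = ≤-trans (m≤m+n k 1) (m⊔n≤o⇒n≤o N (k + 1) N⊔[k+1]≤n)
    M₀+k≤n = m⊔n≤o⇒m≤o (M₀ + k) M₁ N≤n
    M₁≤n = m⊔n≤o⇒n≤o (M₀ + k) M₁ N≤n
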